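{- Let $n\ge 1$ and let $\Gamma$ be the matching derangement graph on the set $\mathcal{M}_{2n}$ of perfect matchings of $K_{2n}$. The chromatic number of $\Gamma$ is $2n-1$.
   Context: The matching derangement graph $\Gamma$ has vertex set $\mathcal{M}_{2n}$, the set of all perfect matchings of the complete graph $K_{2n}$, and two perfect matchings are adjacent if and only if they share no edge. -}

module Defs where

open import Data.Nat using (ℕ; _*_; _∸_; _<_)
open import Data.Fin using (Fin)
open import Data.Product using (Σ; _×_; ∃-syntax)
open import Relation.Binary.PropositionalEquality using (_≡_; _≢_)
open import Relation.Nullary using (¬_)

-- A perfect matching of the complete graph K_v on vertex set Fin v, given by
-- its partner function: p i is the vertex matched to i.  The edge set of the
-- matching is { {i , p i} }.  Every vertex lies in exactly one edge, which is
-- encoded by p being an involution without fixed points.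
record PerfectMatching (v : ℕ) : Set where
  constructor pm
  field
    partner    : Fin v → Fin v
    no-loop    : ∀ i → partner i ≢ i
    involutive : ∀ i → partner (partner i) ≡ i
open PerfectMatching public

IsEdge : ∀ {v} → PerfectMatching v → Fin v → Fin v → Set
IsEdge M i j = partner M i ≡ j

Adjacent : ∀ {v} → PerfectMatching v → PerfectMatching v → Set
Adjacent M N = ¬ (∃[ i ] ∃[ j ] (IsEdge M i j × IsEdge N i j))

ProperColouring : ℕ → ℕ → Set
ProperColouring v k =
  Σ (PerfectMatching v → Fin k) λ c →
    ∀ M N → Adjacent M N → c M ≢ c N

ChromaticNumber≡ : ℕ → ℕ → Set
ChromaticNumber≡ v χ = ProperColouring v χ × (∀ k → k < χ → ¬ ProperColouring v k)

-- Colouring a perfect matching by the partner of one fixed vertex uses 2n − 1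
-- colours, and two matchings with the same colour share an edge.  Conversely
-- K_{2n} has a 1-factorisation, i.e. 2n − 1 pairwise edge-disjoint perfect
-- matchings, which form a clique.  The round-robin one comes from K_m, m = 2n − 1
-- odd, with vertices ℤ/m: the near-perfect matching x ↔ 2a − x misses only a
-- (2 is invertible mod m), distinct a give disjoint such matchings, and adding
-- a new vertex matched to a completes each one to a perfect matching of K_{m+1}.
module Submission where

open import Defs
open import Data.Nat using (ℕ; _*_; _∸_; _≥_)
open import Data.Nat.Base using (suc; _+_; _≤_; _<_)
open import Data.Nat.Properties
open import Data.Nat.Tactic.RingSolver using (solve-∀)
open import Data.Fin.Base as Fin using (Fin; toℕ; fromℕ<; punchOut)
import Data.Fin.Properties as Finₚ
open import Data.Product using (_,_)
open import Data.Empty using (⊥; ⊥-elim)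
open import Function using (_∘_)
open import Relation.Nullary using (¬_; yes; no; contradiction)
open import Relation.Binary.PropositionalEquality

-- For residues x, y, c < m this says x + y ≡ c (mod m).
data ModularSum (m x y c : ℕ) : Set where
  exact : x + y ≡ c     → ModularSum m x y c
  wraps : x + y ≡ c + m → ModularSum m x y c

addMod : ℕ → ℕ → ℕ → ℕ
addMod m x y with x + y <? m
... | yes _ = x + y
... | no  _ = x + y ∸ m

subMod : ℕ → ℕ → ℕ → ℕ
subMod m c x with x ≤? c
... | yes _ = c ∸ x
... | no  _ = c + m ∸ x

addMod-sum : ∀ m x y → ModularSum m x y (addMod m x y)
addMod-sum m x y with x + y <? m
... | yes _     = exact refl
... | no  x+y≮m = wraps (sym (m∸n+n≡m (≮⇒≥ x+y≮m)))

addMod-< : ∀ {m x y} → x < m → y < m → addMod m x y < m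
addMod-< {m} {x} {y} x<m y<m with x + y <? m
... | yes x+y<m = x+y<m
... | no  x+y≮m = +-cancelʳ-< m (x + y ∸ m) m
  (subst (_< m + m) (sym (m∸n+n≡m (≮⇒≥ x+y≮m))) (+-mono-< x<m y<m))

subMod-sum : ∀ {m} c {x} → x < m → ModularSum m (subMod m c x) x c
subMod-sum {m} c {x} x<m with x ≤? c
... | yes x≤c = exact (m∸n+n≡m x≤c)
... | no  _   = wraps (m∸n+n≡m (≤-trans (<⇒≤ x<m) (m≤n+m m c)))

subMod-< : ∀ {m c x} → c < m → x < m → subMod m c x < m
subMod-< {m} {c} {x} c<m x<m with x ≤? c
... | yes _   = ≤-<-trans (m∸n≤m c x) c<m
... | no  x≰c = +-cancelʳ-< x (c + m ∸ x) m
  (subst₂ _<_ (sym (m∸n+n≡m (≤-trans (<⇒≤ x<m) (m≤n+m m c)))) (+-comm x m)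
          (+-monoˡ-< m (≰⇒> x≰c)))

wrap-impossible : ∀ {m x y z c} → y < m → x + z ≡ c → y + z ≡ c + m → ⊥
wrap-impossible {m} {x} {y} {z} {c} y<m x+z≡c y+z≡c+m =
  <⇒≱ (+-monoˡ-< z y<m) (begin
    m + z     ≡⟨ +-comm m z ⟩
    z + m     ≤⟨ +-monoˡ-≤ m (m≤n+m z x) ⟩
    x + z + m ≡⟨ cong (_+ m) x+z≡c ⟩
    c + m     ≡⟨ sym y+z≡c+m ⟩
    y + z     ∎)
  where open ≤-Reasoning

ModularSum-comm : ∀ {m x y c} → ModularSum m x y c → ModularSum m y x c
ModularSum-comm {x = x} {y} (exact e) = exact (trans (+-comm y x) e)
ModularSum-comm {x = x} {y} (wraps e) = wraps (trans (+-comm y x) e)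

ModularSum-cancelʳ : ∀ {m x y z c} → x < m → y < m →
                     ModularSum m x z c → ModularSum m y z c → x ≡ y
ModularSum-cancelʳ {z = z} _ _ (exact e) (exact e′) = +-cancelʳ-≡ z _ _ (trans e (sym e′))
ModularSum-cancelʳ _ y<m (exact e) (wraps e′) = ⊥-elim (wrap-impossible y<m e e′)
ModularSum-cancelʳ x<m _ (wraps e) (exact e′) = ⊥-elim (wrap-impossible x<m e′ e)
ModularSum-cancelʳ {z = z} _ _ (wraps e) (wraps e′) = +-cancelʳ-≡ z _ _ (trans e (sym e′))

ModularSum-functional : ∀ {m x y c c′} → c < m → c′ < m →
                        ModularSum m x y c → ModularSum m x y c′ → c ≡ c′
ModularSum-functional _ _ (exact e) (exact e′) = trans (sym e) e′
ModularSum-functional {m} {c′ = c′} c<m _ (exact e) (wraps e′) =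
  contradiction (subst (m ≤_) (trans (sym e′) e) (m≤n+m m c′)) (<⇒≱ c<m)
ModularSum-functional {m} {c = c} _ c′<m (wraps e) (exact e′) =
  contradiction (subst (m ≤_) (trans (sym e) e′) (m≤n+m m c)) (<⇒≱ c′<m)
ModularSum-functional {m} {c = c} {c′} _ _ (wraps e) (wraps e′) =
  +-cancelʳ-≡ m c c′ (trans (sym e) e′)

m+m≡2*m : ∀ m → m + m ≡ 2 * m
m+m≡2*m m = cong (m +_) (sym (+-identityʳ m))

m+m-injective : ∀ {m n} → m + m ≡ n + n → m ≡ n
m+m-injective {m} {n} eq = *-cancelˡ-≡ m n 2 (trans (sym (m+m≡2*m m)) (trans eq (m+m≡2*m n)))

m+m≢n+n+odd : ∀ m n k → m + m ≢ n + n + suc (2 * k)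
m+m≢n+n+odd m n k eq =
  even≢odd m (n + k) (trans (sym (m+m≡2*m m)) (trans eq (odd-shift n k)))
  where
  odd-shift : ∀ n k → n + n + suc (2 * k) ≡ suc (2 * (n + k))
  odd-shift = solve-∀

ModularSum-halve : ∀ {k x y c} →
                   ModularSum (suc (2 * k)) x x c → ModularSum (suc (2 * k)) y y c → x ≡ y
ModularSum-halve (exact e) (exact e′) = m+m-injective (trans e (sym e′))
ModularSum-halve {k} {x} {y} (exact e) (wraps e′) =
  contradiction (trans e′ (cong (_+ suc (2 * k)) (sym e))) (m+m≢n+n+odd y x k)
ModularSum-halve {k} {x} {y} (wraps e) (exact e′) =
  contradiction (trans e (cong (_+ suc (2 * k)) (sym e′))) (m+m≢n+n+odd x y k)
ModularSum-halve (wraps e) (wraps e′) = m+m-injective (trans e (sym e′))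

-- swap a is the partner function of a near-perfect matching of K_m missing
-- the vertex a.
record NearOneFactorisation (m : ℕ) : Set where
  field
    swap            : Fin m → Fin m → Fin m
    swap-involutive : ∀ a x → swap a (swap a x) ≡ x
    swap-fixes      : ∀ a → swap a a ≡ a
    swap-fixed⇒≡    : ∀ a x → swap a x ≡ x → x ≡ a
    swap-injectiveˡ : ∀ a b x → swap a x ≡ swap b x → a ≡ b

module OneFactorisation {m : ℕ} (F : NearOneFactorisation m) where
  open NearOneFactorisation F

  swap-hits⇒≡ : ∀ a x → swap a x ≡ a → x ≡ a
  swap-hits⇒≡ a x eq = begin
    x                 ≡⟨ sym (swap-involutive a x) ⟩
    swap a (swap a x) ≡⟨ cong (swap a) eq ⟩
    swap a a          ≡⟨ swap-fixes a ⟩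
    a                 ∎
    where open ≡-Reasoning

  -- The new vertex is Fin.zero; it is matched to the vertex missed by swap a.
  extend : Fin m → Fin (suc m) → Fin (suc m)
  extend a Fin.zero = Fin.suc a
  extend a (Fin.suc x) with x Finₚ.≟ a
  ... | yes _ = Fin.zero
  ... | no  _ = Fin.suc (swap a x)

  extend-no-loop : ∀ a i → extend a i ≢ i
  extend-no-loop a Fin.zero = λ ()
  extend-no-loop a (Fin.suc x) with x Finₚ.≟ a
  ... | yes _   = λ ()
  ... | no  x≢a = x≢a ∘ swap-fixed⇒≡ a x ∘ Finₚ.suc-injective

  extend-involutive : ∀ a i → extend a (extend a i) ≡ i
  extend-involutive a Fin.zero with a Finₚ.≟ a
  ... | yes _   = refl
  ... | no  a≢a = contradiction refl a≢a
  extend-involutive a (Fin.suc x) with x Finₚ.≟ a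
  ... | yes x≡a = cong Fin.suc (sym x≡a)
  ... | no  x≢a with swap a x Finₚ.≟ a
  ...   | yes sx≡a = contradiction (swap-hits⇒≡ a x sx≡a) x≢a
  ...   | no  _    = cong Fin.suc (swap-involutive a x)

  extend-injectiveˡ : ∀ a b i → extend a i ≡ extend b i → a ≡ b
  extend-injectiveˡ a b Fin.zero eq = Finₚ.suc-injective eq
  extend-injectiveˡ a b (Fin.suc x) eq with x Finₚ.≟ a | x Finₚ.≟ b
  ... | yes x≡a | yes x≡b = trans (sym x≡a) x≡b
  ... | yes _   | no  _   = contradiction eq λ ()
  ... | no  _   | yes _   = contradiction eq λ ()
  ... | no  _   | no  _   = swap-injectiveˡ a b x (Finₚ.suc-injective eq)

  oneFactor : Fin m → PerfectMatching (suc m)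
  oneFactor a = pm (extend a) (extend-no-loop a) (extend-involutive a)

  oneFactor-adjacent : ∀ {a b} → a ≢ b → Adjacent (oneFactor a) (oneFactor b)
  oneFactor-adjacent {a} {b} a≢b (i , j , ai≡j , bi≡j) =
    a≢b (extend-injectiveˡ a b i (trans ai≡j (sym bi≡j)))

module RoundRobin (k : ℕ) where
  m : ℕ
  m = suc (2 * k)

  centre : Fin m → ℕ
  centre a = addMod m (toℕ a) (toℕ a)

  centre-< : ∀ a → centre a < m
  centre-< a = addMod-< (Finₚ.toℕ<n a) (Finₚ.toℕ<n a)

  centre-sum : ∀ a → ModularSum m (toℕ a) (toℕ a) (centre a)
  centre-sum a = addMod-sum m (toℕ a) (toℕ a)

  reflect : Fin m → Fin m → Fin m
  reflect a x = fromℕ< (subMod-< {m} (centre-< a) (Finₚ.toℕ<n x))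

  reflect-sum : ∀ a x → ModularSum m (toℕ (reflect a x)) (toℕ x) (centre a)
  reflect-sum a x rewrite Finₚ.toℕ-fromℕ< (subMod-< {m} (centre-< a) (Finₚ.toℕ<n x)) =
    subMod-sum (centre a) (Finₚ.toℕ<n x)

  reflect-involutive : ∀ a x → reflect a (reflect a x) ≡ x
  reflect-involutive a x = Finₚ.toℕ-injective
    (ModularSum-cancelʳ (Finₚ.toℕ<n _) (Finₚ.toℕ<n x)
      (reflect-sum a (reflect a x)) (ModularSum-comm (reflect-sum a x)))

  reflect-fixes : ∀ a → reflect a a ≡ a
  reflect-fixes a = Finₚ.toℕ-injective
    (ModularSum-cancelʳ (Finₚ.toℕ<n _) (Finₚ.toℕ<n a) (reflect-sum a a) (centre-sum a))

  reflect-fixed⇒≡ : ∀ a x → reflect a x ≡ x → x ≡ a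
  reflect-fixed⇒≡ a x eq = Finₚ.toℕ-injective
    (ModularSum-halve {k} (subst (λ y → ModularSum m (toℕ y) (toℕ x) (centre a)) eq (reflect-sum a x))
                      (centre-sum a))

  reflect-injectiveˡ : ∀ a b x → reflect a x ≡ reflect b x → a ≡ b
  reflect-injectiveˡ a b x eq = Finₚ.toℕ-injective (ModularSum-halve {k} (centre-sum a) centre-sum′)
    where
    centres-equal : centre a ≡ centre b
    centres-equal = ModularSum-functional (centre-< a) (centre-< b)
      (subst (λ y → ModularSum m (toℕ y) (toℕ x) (centre a)) eq (reflect-sum a x))
      (reflect-sum b x)

    centre-sum′ : ModularSum m (toℕ b) (toℕ b) (centre a)
    centre-sum′ = subst (ModularSum m (toℕ b) (toℕ b)) (sym centres-equal) (centre-sum b)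

  roundRobin : NearOneFactorisation m
  roundRobin = record
    { swap            = reflect
    ; swap-involutive = reflect-involutive
    ; swap-fixes      = reflect-fixes
    ; swap-fixed⇒≡    = reflect-fixed⇒≡
    ; swap-injectiveˡ = reflect-injectiveˡ
    }

colourByPartnerOfZero : ∀ m → ProperColouring (suc m) m
colourByPartnerOfZero m = colour , proper
  where
  zero≢partner : ∀ M → Fin.zero ≢ partner M Fin.zero
  zero≢partner M = no-loop M Fin.zero ∘ sym

  colour : PerfectMatching (suc m) → Fin m
  colour M = punchOut (zero≢partner M)

  proper : ∀ M N → Adjacent M N → colour M ≢ colour N
  proper M N adj eq = adj (Fin.zero , partner M Fin.zero , refl ,
    sym (Finₚ.punchOut-injective (zero≢partner M) (zero≢partner N) eq))

clique⇒¬colouring : ∀ {v m k} (f : Fin m → PerfectMatching v) →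
                    (∀ {a b} → a ≢ b → Adjacent (f a) (f b)) →
                    k < m → ¬ ProperColouring v k
clique⇒¬colouring f clique k<m (c , proper)
  with Finₚ.pigeonhole k<m (c ∘ f)
... | a , b , a<b , ca≡cb = proper (f a) (f b) (clique (Finₚ.<⇒≢ a<b)) ca≡cb

chromaticNumber-nearOneFactorisable : ∀ {m} → NearOneFactorisation m →
                                      ChromaticNumber≡ (suc m) m
chromaticNumber-nearOneFactorisable {m} F =
  colourByPartnerOfZero m ,
  λ k k<m → clique⇒¬colouring oneFactor oneFactor-adjacent k<m
  where open OneFactorisation F

theorem3p3 : ∀ (n : ℕ) → n ≥ 1 → ChromaticNumber≡ (2 * n) (2 * n ∸ 1)
theorem3p3 (suc k) _ =
  subst (λ v → ChromaticNumber≡ v (v ∸ 1)) (sym (*-suc 2 k))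
        (chromaticNumber-nearOneFactorisable (RoundRobin.roundRobin k))
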